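{- Let $m,n$ be coprime positive integers and let $D$ be an $(m,n)$-Dyck path. A set $R=\{r_0,\dots,r_{m+n-1}\}$ is the rank set of $D$ if and only if $\bar R=M-R=\{M-r_0,\dots,M-r_{m+n-1}\}$, where $M=\max R$, is the rank set of the rank complement $\bar D$.
   Context: A path is a word in the letters $N$ (unit step $(0,1)$) and $E$ (unit step $(1,0)$), drawn as the sequence of lattice points $P_0=(0,0),P_1,\dots,P_{k}$. An $(m,n)$-Dyck path is a path from $(0,0)$ to $(m,n)$ that never goes below the line $y=\frac nm x$. The rank of a lattice point $(a,b)$ is $r(a,b)=mb-na$; the rank set of a path $D$ from $(0,0)$ to $(m,n)$ is $r(D)=\{r(P_0),\dots,r(P_{m+n-1})\}$ (distinct integers when $m,n$ are coprime; $D$ is a Dyck path iff all are nonnegative). For a path $Q$, $Q^{rev}$ denotes the path whose word is that of $Q$ read backwards. Rank complement: write the word of $D$ as $D=Q_1Q_2$, where $Q_1$ consists of the steps up to the (unique) lattice point of $D$ of maximal rank; then $\bar D=Q_1^{rev}Q_2^{rev}$ (concatenation of words), which is again an $(m,n)$-Dyck path. -}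

module Defs where

open import Data.Nat as ℕ using (ℕ; zero; suc)
open import Data.Integer as ℤ using (ℤ; +_; _-_; _*_; _≤_; _<?_; _⊔_)
open import Data.List using (List; []; _∷_; _++_; map; take; drop; reverse; length; foldr)
open import Data.List.Relation.Unary.All using (All)
open import Data.Product using (_×_; _,_)
open import Data.Bool using (if_then_else_)
open import Relation.Nullary using (does)
open import Relation.Binary.PropositionalEquality using (_≡_)
open import Function.Bundles using (_⇔_)
open import Data.List.Membership.Propositional using (_∈_)

data Step : Set where
  N E : Step

Path : Set
Path = List Step

Point : Set
Point = ℤ × ℤ

move : Point → Step → Point
move (a , b) N = (a , b ℤ.+ + 1)
move (a , b) E = (a ℤ.+ + 1 , b)

initPointsFrom : Point → Path → List Point
initPointsFrom p []      = []
initPointsFrom p (s ∷ w) = p ∷ initPointsFrom (move p s) w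

endFrom : Point → Path → Point
endFrom p []      = p
endFrom p (s ∷ w) = endFrom (move p s) w

origin : Point
origin = (+ 0 , + 0)

initPoints : Path → List Point
initPoints = initPointsFrom origin

allPoints : Path → List Point
allPoints D = initPoints D ++ (endFrom origin D ∷ [])

rank : ℕ → ℕ → Point → ℤ
rank m n (a , b) = (+ m) * b - (+ n) * a

rankSet : ℕ → ℕ → Path → List ℤ
rankSet m n D = map (rank m n) (initPoints D)

countE countN : Path → ℕ
countE []      = 0
countE (N ∷ w) = countE w
countE (E ∷ w) = suc (countE w)
countN []      = 0
countN (N ∷ w) = suc (countN w)
countN (E ∷ w) = countN w

-- (m,n)-Dyck path: from (0,0) to (m,n), never below y = (n/m) x,
-- i.e. every lattice point has nonnegative rank.
IsDyck : ℕ → ℕ → Path → Set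
IsDyck m n D = (countE D ≡ m) × (countN D ≡ n)
             × All (λ P → + 0 ≤ rank m n P) (allPoints D)

argmaxAux : ℕ → ℕ → ℤ → List ℤ → ℕ
argmaxAux i b v []       = b
argmaxAux i b v (y ∷ ys) =
  if does (v <? y) then argmaxAux (suc i) i y ys else argmaxAux (suc i) b v ys

argmax : List ℤ → ℕ
argmax []       = 0
argmax (x ∷ xs) = argmaxAux 1 0 x xs

-- rank complement: D = Q1 Q2 with Q1 the steps up to the point of maximal
-- rank; D̄ = Q1^rev Q2^rev.
rankComplement : ℕ → ℕ → Path → Path
rankComplement m n D =
  reverse (take k D) ++ reverse (drop k D)
  where k = argmax (map (rank m n) (allPoints D))

-- maximum of a list of integers (used on rank sets, which contain r(P_0)=0
-- and are nonnegative, so the seed 0 does not affect the value)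
maxList : List ℤ → ℤ
maxList = foldr _⊔_ (+ 0)

_≈ₛ_ : List ℤ → List ℤ → Set
A ≈ₛ B = ∀ x → (x ∈ A) ⇔ (x ∈ B)

module Submission where

-- Along a path each N step adds m to the rank and each E step subtracts n,
-- so the ranks of the lattice points are partial sums of step increments;
-- the argument works with these rank sequences ('ranksFrom', 'laterRanks',
-- 'finalRank', 'trajectory') rather than with the points themselves.
--
-- Then, on rank sequences:
--  * reading a path backwards reflects its ranks, x ↦ (start + end) - x
--    (ranksFrom-reverse);
--  * hence for a closed path T V from rank 0 and ANY split point the ranks
--    of T^rev V^rev are, up to order, h - r(T V), with h the rank at the
--    split point (complement-ranks);
--  * at the split point chosen by 'argmax' the rank is maximal
--    (maxRank-at-split).

open import Defs
open import Data.Nat using (ℕ; _≤_)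
open import Data.Nat.Coprimality using (Coprime)
open import Data.Integer using (_-_)
open import Data.List using (map)

open import Data.Nat using (zero; suc)
open import Data.Integer as ℤ using (ℤ; +_; _+_; _*_; _<?_)
import Data.Integer.Properties as ℤP
open import Data.Integer.Tactic.RingSolver using (solve-∀)
open import Data.List using (List; []; _∷_; _++_; _∷ʳ_; take; drop; reverse; length)
open import Data.List.Properties
  using (map-++; ++-identityʳ; unfold-reverse; take++drop≡id; ∷ʳ-++)
open import Data.List.Relation.Unary.All as All using (All; []; _∷_)
import Data.List.Relation.Unary.All.Properties as AllP
open import Data.List.Relation.Unary.Any using (here; there)
open import Data.List.Membership.Propositional using (_∈_)
open import Data.List.Relation.Binary.Permutation.Propositional
  using (_↭_; ↭-sym; module PermutationReasoning)
open import Data.List.Relation.Binary.Permutation.Propositional.Properties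
  using (∈-resp-↭; ↭-reverse; ++⁺; map⁺; drop-∷; ++-comm)
open import Data.Product using (_×_; _,_; ∃)
open import Relation.Nullary using (yes; no)
open import Relation.Binary.PropositionalEquality
open import Function.Bundles using (mk⇔)

IsMaximum : ℤ → List ℤ → Set
IsMaximum d l = d ∈ l × All (ℤ._≤ d) l

-- 'maxList' folds with seed 0, so it is the largest entry of xs ∷ʳ 0.
maxList-bounds : ∀ xs → All (ℤ._≤ maxList xs) (xs ∷ʳ + 0)
maxList-bounds []       = ℤP.≤-refl ∷ []
maxList-bounds (x ∷ xs) =
  ℤP.i≤i⊔j x (maxList xs) ∷ All.map (λ p → ℤP.≤-trans p (ℤP.i≤j⊔i x (maxList xs))) (maxList-bounds xs)

maxList-least : ∀ xs {d} → All (ℤ._≤ d) (xs ∷ʳ + 0) → maxList xs ℤ.≤ d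
maxList-least []       (0≤d ∷ []) = 0≤d
maxList-least (x ∷ xs) (x≤d ∷ ps) = ℤP.⊔-lub x≤d (maxList-least xs ps)

maxList-unique : ∀ xs {d} → IsMaximum d (xs ∷ʳ + 0) → maxList xs ≡ d
maxList-unique xs (d∈ , bound) = ℤP.≤-antisym (maxList-least xs bound) (All.lookup (maxList-bounds xs) d∈)

Peak : ℕ → ℤ → List ℤ → Set
Peak k w l = (∃ λ rest → drop k l ≡ w ∷ rest) × All (ℤ._≤ w) l

drop-∈ : ∀ k (l : List ℤ) {w rest} → drop k l ≡ w ∷ rest → w ∈ l
drop-∈ zero    l       refl = here refl
drop-∈ (suc k) (x ∷ l) at   = there (drop-∈ k l at)

drop-++ : ∀ k (xs ys : List ℤ) {w rest} → drop k xs ≡ w ∷ rest → drop k (xs ++ ys) ≡ w ∷ rest ++ ys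
drop-++ zero    xs       ys at = cong (_++ ys) at
drop-++ (suc k) (x ∷ xs) ys at = drop-++ k xs ys at

drop-length : ∀ (xs ys : List ℤ) → drop (length xs) (xs ++ ys) ≡ ys
drop-length []       ys = refl
drop-length (x ∷ xs) ys = drop-length xs ys

length-∷ʳ : ∀ (xs : List ℤ) x → length (xs ∷ʳ x) ≡ suc (length xs)
length-∷ʳ []       x = refl
length-∷ʳ (_ ∷ xs) x = cong suc (length-∷ʳ xs x)

-- Loop invariant of 'argmaxAux': if b is a peak (of value v) of the prefix
-- ps already scanned, whose length i is the position of the next entry,
-- then the final answer is a peak of the whole list.
argmaxAux-peak : ∀ ys ps {i b v} → length ps ≡ i → Peak b v ps →
  ∃ λ w → Peak (argmaxAux i b v ys) w (ps ++ ys)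
argmaxAux-peak []       ps {b = b} {v} _ peak = v , subst (Peak b v) (sym (++-identityʳ ps)) peak
argmaxAux-peak (y ∷ ys) ps {i} {b} {v} len ((_ , at) , bound) with v <? y
... | yes v<y = subst (λ l → ∃ λ w → Peak (argmaxAux (suc i) i y ys) w l) (∷ʳ-++ ps y ys)
                  (argmaxAux-peak ys (ps ∷ʳ y) {b = i} (trans (length-∷ʳ ps y) (cong suc len)) ((_ , y-at) , y-bound))
  where
  y-at : drop i (ps ∷ʳ y) ≡ y ∷ []
  y-at = subst (λ k → drop k (ps ∷ʳ y) ≡ y ∷ []) len (drop-length ps (y ∷ []))
  y-bound : All (ℤ._≤ y) (ps ∷ʳ y)
  y-bound = AllP.++⁺ (All.map (λ p → ℤP.≤-trans p (ℤP.<⇒≤ v<y)) bound) (ℤP.≤-refl ∷ [])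
... | no v≮y = subst (λ l → ∃ λ w → Peak (argmaxAux (suc i) b v ys) w l) (∷ʳ-++ ps y ys)
                 (argmaxAux-peak ys (ps ∷ʳ y) {b = b} (trans (length-∷ʳ ps y) (cong suc len))
                   ((_ , drop-++ b ps (y ∷ []) at) , AllP.++⁺ bound (ℤP.≮⇒≥ v≮y ∷ [])))

argmax-peak : ∀ x xs → ∃ λ w → Peak (argmax (x ∷ xs)) w (x ∷ xs)
argmax-peak x xs = argmaxAux-peak xs (x ∷ []) refl ((_ , refl) , ℤP.≤-refl ∷ [])

module RankSequences (m n : ℕ) where

  δ : Step → ℤ
  δ N = + m
  δ E = ℤ.- (+ n)

  ranksFrom laterRanks : ℤ → Path → List ℤ
  ranksFrom a []       = []
  ranksFrom a (s ∷ w)  = a ∷ ranksFrom (a + δ s) w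
  laterRanks a []      = []
  laterRanks a (s ∷ w) = (a + δ s) ∷ laterRanks (a + δ s) w

  finalRank : ℤ → Path → ℤ
  finalRank a []      = a
  finalRank a (s ∷ w) = finalRank (a + δ s) w

  trajectory : ℤ → Path → List ℤ
  trajectory a w = a ∷ laterRanks a w

  trajectory-split : ∀ a w → ranksFrom a w ∷ʳ finalRank a w ≡ trajectory a w
  trajectory-split a []      = refl
  trajectory-split a (s ∷ w) = cong (a ∷_) (trajectory-split (a + δ s) w)

  finalRank-++ : ∀ a u v → finalRank a (u ++ v) ≡ finalRank (finalRank a u) v
  finalRank-++ a []      v = refl
  finalRank-++ a (s ∷ u) v = finalRank-++ (a + δ s) u v

  ranksFrom-++ : ∀ a u v → ranksFrom a (u ++ v) ≡ ranksFrom a u ++ ranksFrom (finalRank a u) v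
  ranksFrom-++ a []      v = refl
  ranksFrom-++ a (s ∷ u) v = cong (a ∷_) (ranksFrom-++ (a + δ s) u v)

  laterRanks-++ : ∀ a u v → laterRanks a (u ++ v) ≡ laterRanks a u ++ laterRanks (finalRank a u) v
  laterRanks-++ a []      v = refl
  laterRanks-++ a (s ∷ u) v = cong ((a + δ s) ∷_) (laterRanks-++ (a + δ s) u v)

  finalRank-counts : ∀ a w → finalRank a w ≡ a + (+ m * + countN w - + n * + countE w)
  finalRank-counts a []      = no-steps a (+ m) (+ n)
    where
    no-steps : ∀ a M K → a ≡ a + (M * + 0 - K * + 0)
    no-steps = solve-∀
  finalRank-counts a (N ∷ w) = begin
    finalRank (a + + m) w                                 ≡⟨ finalRank-counts (a + + m) w ⟩
    a + + m + (+ m * + countN w - + n * + countE w)       ≡⟨ N-step a (+ m) (+ n) (+ countN w) (+ countE w) ⟩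
    a + (+ m * (+ 1 + + countN w) - + n * + countE w)    ≡⟨ cong (λ y → a + (+ m * y - + n * + countE w)) (sym (ℤP.pos-+ 1 (countN w))) ⟩
    a + (+ m * + suc (countN w) - + n * + countE w)       ∎
    where
    open ≡-Reasoning
    N-step : ∀ a M K y x → a + M + (M * y - K * x) ≡ a + (M * (+ 1 + y) - K * x)
    N-step = solve-∀
  finalRank-counts a (E ∷ w) = begin
    finalRank (a + ℤ.- (+ n)) w                             ≡⟨ finalRank-counts (a + ℤ.- (+ n)) w ⟩
    a + ℤ.- (+ n) + (+ m * + countN w - + n * + countE w)   ≡⟨ E-step a (+ m) (+ n) (+ countN w) (+ countE w) ⟩
    a + (+ m * + countN w - + n * (+ 1 + + countE w))    ≡⟨ cong (λ x → a + (+ m * + countN w - + n * x)) (sym (ℤP.pos-+ 1 (countE w))) ⟩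
    a + (+ m * + countN w - + n * + suc (countE w))       ∎
    where
    open ≡-Reasoning
    E-step : ∀ a M K y x → a + ℤ.- K + (M * y - K * x) ≡ a + (M * y - K * (+ 1 + x))
    E-step = solve-∀

  rotation : ∀ a w → finalRank a w ≡ a → laterRanks a w ↭ ranksFrom a w
  rotation a w closed = drop-∷ (begin
    a ∷ laterRanks a w              ≡⟨ trajectory-split a w ⟨
    ranksFrom a w ∷ʳ finalRank a w  ≡⟨ cong (ranksFrom a w ∷ʳ_) closed ⟩
    ranksFrom a w ∷ʳ a              ↭⟨ ++-comm (ranksFrom a w) (a ∷ []) ⟩
    a ∷ ranksFrom a w               ∎)
    where open PermutationReasoning

  finalRank-reverse : ∀ c a u → finalRank c (reverse u) ≡ c + (finalRank a u - a)
  finalRank-reverse c a []      = cancel c a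
    where
    cancel : ∀ c a → c ≡ c + (a - a)
    cancel = solve-∀
  finalRank-reverse c a (s ∷ u) = begin
    finalRank c (reverse (s ∷ u))                    ≡⟨ cong (finalRank c) (unfold-reverse s u) ⟩
    finalRank c (reverse u ∷ʳ s)                     ≡⟨ finalRank-++ c (reverse u) (s ∷ []) ⟩
    finalRank c (reverse u) + δ s                    ≡⟨ cong (_+ δ s) (finalRank-reverse c (a + δ s) u) ⟩
    c + (finalRank a (s ∷ u) - (a + δ s)) + δ s      ≡⟨ regroup c (finalRank a (s ∷ u)) a (δ s) ⟩
    c + (finalRank a (s ∷ u) - a)                    ∎
    where
    open ≡-Reasoning
    regroup : ∀ c F a d → c + (F - (a + d)) + d ≡ c + (F - a)
    regroup = solve-∀

  ranksFrom-reverse : ∀ c a u →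
    ranksFrom c (reverse u) ≡ reverse (map (λ x → c + finalRank a u - x) (laterRanks a u))
  ranksFrom-reverse c a []      = refl
  ranksFrom-reverse c a (s ∷ u) = begin
    ranksFrom c (reverse (s ∷ u))                        ≡⟨ cong (ranksFrom c) (unfold-reverse s u) ⟩
    ranksFrom c (reverse u ∷ʳ s)                         ≡⟨ ranksFrom-++ c (reverse u) (s ∷ []) ⟩
    ranksFrom c (reverse u) ∷ʳ finalRank c (reverse u)   ≡⟨ cong₂ _∷ʳ_ (ranksFrom-reverse c (a + δ s) u) lastPoint ⟩
    reverse (map reflect later) ∷ʳ reflect (a + δ s)     ≡⟨ unfold-reverse (reflect (a + δ s)) (map reflect later) ⟨
    reverse (map reflect (laterRanks a (s ∷ u)))         ∎
    where
    open ≡-Reasoning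
    F : ℤ
    F = finalRank a (s ∷ u)
    later : List ℤ
    later = laterRanks (a + δ s) u
    reflect : ℤ → ℤ
    reflect x = c + F - x
    regroup : ∀ c F a → c + (F - a) ≡ c + F - a
    regroup = solve-∀
    lastPoint : finalRank c (reverse u) ≡ reflect (a + δ s)
    lastPoint = trans (finalRank-reverse c (a + δ s) u) (regroup c F (a + δ s))

  -- For a closed path T V from rank 0, split anywhere, the ranks of
  -- T^rev V^rev are, up to order, h - x for the ranks x of T V, where h is
  -- the rank at the split point; T^rev ends at h and V^rev starts there.
  complement-ranks : ∀ T V → finalRank (+ 0) (T ++ V) ≡ + 0 →
    ranksFrom (+ 0) (reverse T ++ reverse V) ↭ map (finalRank (+ 0) T -_) (ranksFrom (+ 0) (T ++ V))
  complement-ranks T V closed = begin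
    ranksFrom (+ 0) (reverse T ++ reverse V)                ≡⟨ ranksFrom-++ (+ 0) (reverse T) (reverse V) ⟩
    ranksFrom (+ 0) (reverse T) ++ ranksFrom c (reverse V)  ≡⟨ cong₂ _++_ firstHalf secondHalf ⟩
    reverse (map (h -_) lT) ++ reverse (map (h -_) lV)      ↭⟨ ++⁺ (↭-reverse (map (h -_) lT)) (↭-reverse (map (h -_) lV)) ⟩
    map (h -_) lT ++ map (h -_) lV                          ≡⟨ map-++ (h -_) lT lV ⟨
    map (h -_) (lT ++ lV)                                   ≡⟨ cong (map (h -_)) (laterRanks-++ (+ 0) T V) ⟨
    map (h -_) (laterRanks (+ 0) (T ++ V))                  ↭⟨ map⁺ (h -_) (rotation (+ 0) (T ++ V) closed) ⟩
    map (h -_) (ranksFrom (+ 0) (T ++ V))                   ∎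
    where
    open PermutationReasoning
    h c : ℤ
    h = finalRank (+ 0) T
    c = finalRank (+ 0) (reverse T)
    lT lV : List ℤ
    lT = laterRanks (+ 0) T
    lV = laterRanks h V
    turn : ∀ h → + 0 + (h - + 0) ≡ h
    turn = solve-∀
    c≡h : c ≡ h
    c≡h = trans (finalRank-reverse (+ 0) (+ 0) T) (turn h)
    V-closes : finalRank h V ≡ + 0
    V-closes = trans (sym (finalRank-++ (+ 0) T V)) closed
    firstHalf : ranksFrom (+ 0) (reverse T) ≡ reverse (map (h -_) lT)
    firstHalf = trans (ranksFrom-reverse (+ 0) (+ 0) T)
                      (cong (λ z → reverse (map (λ x → z - x) lT)) (ℤP.+-identityˡ h))
    secondHalf : ranksFrom c (reverse V) ≡ reverse (map (h -_) lV)
    secondHalf = trans (ranksFrom-reverse c h V)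
                       (cong (λ z → reverse (map (λ x → z - x) lV))
                             (trans (cong₂ _+_ c≡h V-closes) (ℤP.+-identityʳ h)))

  rankAt : ∀ k a w {x rest} → drop k (trajectory a w) ≡ x ∷ rest → x ≡ finalRank a (take k w)
  rankAt zero          a w       refl = refl
  rankAt (suc zero)    a []      ()
  rankAt (suc (suc k)) a []      ()
  rankAt (suc k)       a (s ∷ w) at   = rankAt k (a + δ s) w at

  maxRank-at-split : ∀ a w →
    IsMaximum (finalRank a (take (argmax (trajectory a w)) w)) (trajectory a w)
  maxRank-at-split a w with argmax-peak a (laterRanks a w)
  ... | x , (_ , at) , bound =
    subst (λ d → IsMaximum d (trajectory a w)) (rankAt k a w at) (drop-∈ k (trajectory a w) at , bound)
    where
    k : ℕ
    k = argmax (trajectory a w)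

open RankSequences

module PointRanks (m n : ℕ) where

  rank-move : ∀ p s → rank m n (move p s) ≡ rank m n p + δ m n s
  rank-move (a , b) N = N-step (+ m) (+ n) a b
    where
    N-step : ∀ M K a b → M * (b + + 1) - K * a ≡ M * b - K * a + M
    N-step = solve-∀
  rank-move (a , b) E = E-step (+ m) (+ n) a b
    where
    E-step : ∀ M K a b → M * b - K * (a + + 1) ≡ M * b - K * a + ℤ.- K
    E-step = solve-∀

  rank-origin : rank m n origin ≡ + 0
  rank-origin = zero-rank (+ m) (+ n)
    where
    zero-rank : ∀ M K → M * + 0 - K * + 0 ≡ + 0
    zero-rank = solve-∀

  ranks-initPoints : ∀ p w → map (rank m n) (initPointsFrom p w) ≡ ranksFrom m n (rank m n p) w
  ranks-initPoints p []      = refl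
  ranks-initPoints p (s ∷ w) =
    cong (rank m n p ∷_) (trans (ranks-initPoints (move p s) w) (cong (λ a → ranksFrom m n a w) (rank-move p s)))

  rank-endFrom : ∀ p w → rank m n (endFrom p w) ≡ finalRank m n (rank m n p) w
  rank-endFrom p []      = refl
  rank-endFrom p (s ∷ w) = trans (rank-endFrom (move p s) w) (cong (λ a → finalRank m n a w) (rank-move p s))

  rankSet-ranksFrom : ∀ D → rankSet m n D ≡ ranksFrom m n (+ 0) D
  rankSet-ranksFrom D = trans (ranks-initPoints origin D) (cong (λ a → ranksFrom m n a D) rank-origin)

  allPoints-trajectory : ∀ D → map (rank m n) (allPoints D) ≡ trajectory m n (+ 0) D
  allPoints-trajectory D = begin
    map (rank m n) (allPoints D)                                       ≡⟨ map-++ (rank m n) (initPoints D) _ ⟩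
    map (rank m n) (initPoints D) ∷ʳ rank m n (endFrom origin D)       ≡⟨ cong₂ _∷ʳ_ (rankSet-ranksFrom D) endRank ⟩
    ranksFrom m n (+ 0) D ∷ʳ finalRank m n (+ 0) D                     ≡⟨ trajectory-split m n (+ 0) D ⟩
    trajectory m n (+ 0) D                                              ∎
    where
    open ≡-Reasoning
    endRank : rank m n (endFrom origin D) ≡ finalRank m n (+ 0) D
    endRank = trans (rank-endFrom origin D) (cong (λ a → finalRank m n a D) rank-origin)

  returnsToZero : ∀ D → countE D ≡ m → countN D ≡ n → finalRank m n (+ 0) D ≡ + 0
  returnsToZero D #E #N = begin
    finalRank m n (+ 0) D                                  ≡⟨ finalRank-counts m n (+ 0) D ⟩
    + 0 + (+ m * + countN D - + n * + countE D)            ≡⟨ cong₂ (λ y x → + 0 + (+ m * + y - + n * + x)) #N #E ⟩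
    + 0 + (+ m * + n - + n * + m)                          ≡⟨ balanced (+ m) (+ n) ⟩
    + 0                                                    ∎
    where
    open ≡-Reasoning
    balanced : ∀ M K → + 0 + (M * K - K * M) ≡ + 0
    balanced = solve-∀

  splitRank-max : ∀ D → finalRank m n (+ 0) D ≡ + 0 →
    finalRank m n (+ 0) (take (argmax (map (rank m n) (allPoints D))) D) ≡ maxList (rankSet m n D)
  splitRank-max D isClosed rewrite allPoints-trajectory D | rankSet-ranksFrom D =
    sym (maxList-unique (ranksFrom m n (+ 0) D)
          (subst (IsMaximum _) (sym trajectory≡) (maxRank-at-split m n (+ 0) D)))
    where
    trajectory≡ : ranksFrom m n (+ 0) D ∷ʳ + 0 ≡ trajectory m n (+ 0) D
    trajectory≡ = trans (cong (ranksFrom m n (+ 0) D ∷ʳ_) (sym isClosed)) (trajectory-split m n (+ 0) D)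

open PointRanks

↭⇒≈ₛ : ∀ {xs ys : List ℤ} → xs ↭ ys → xs ≈ₛ ys
↭⇒≈ₛ xs↭ys x = mk⇔ (∈-resp-↭ xs↭ys) (∈-resp-↭ (↭-sym xs↭ys))

-- In fact r(D̄) is a permutation of max r(D) - r(D); only the fact that D
-- ends at (m,n) is used.
lemma2p3 : (m n : ℕ) → 1 ≤ m → 1 ≤ n → Coprime m n →
    (D : Path) → IsDyck m n D →
    rankSet m n (rankComplement m n D)
      ≈ₛ map (λ r → maxList (rankSet m n D) - r) (rankSet m n D)
lemma2p3 m n _ _ _ D (#E , #N , _) = ↭⇒≈ₛ (begin
  rankSet m n (rankComplement m n D)                        ≡⟨ rankSet-ranksFrom m n (reverse T ++ reverse V) ⟩
  ranksFrom m n (+ 0) (reverse T ++ reverse V)              ↭⟨ complement-ranks m n T V TV-closed ⟩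
  map (h -_) (ranksFrom m n (+ 0) (T ++ V))                 ≡⟨ cong (λ P → map (h -_) (ranksFrom m n (+ 0) P)) (take++drop≡id k D) ⟩
  map (h -_) (ranksFrom m n (+ 0) D)                        ≡⟨ cong₂ (λ M R → map (M -_) R) (splitRank-max m n D D-closed) (sym (rankSet-ranksFrom m n D)) ⟩
  map (λ r → maxList (rankSet m n D) - r) (rankSet m n D)   ∎)
  where
  open PermutationReasoning
  k : ℕ
  k = argmax (map (rank m n) (allPoints D))
  T V : Path
  T = take k D
  V = drop k D
  h : ℤ
  h = finalRank m n (+ 0) T
  D-closed : finalRank m n (+ 0) D ≡ + 0
  D-closed = returnsToZero m n D #E #N
  TV-closed : finalRank m n (+ 0) (T ++ V) ≡ + 0
  TV-closed = trans (cong (finalRank m n (+ 0)) (take++drop≡id k D)) D-closed
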